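{- Let $r\geq 2$ be an integer and $a_2\in\bar{\mathbb{Q}}_2$ with $0<v(a_2)<1$. Let $\alpha':=\frac{a_2^2-2r^2}{2a_2}$, $\tau':=v(\alpha')$ and $t:=v(r-1)$. If $\tau'\geq t$, then $r$ is odd and $v(a_2)=\frac12$.
   Context: $v$ is the $2$-adic valuation on $\bar{\mathbb{Q}}_2$ with $v(2)=1$ (and $v(0)=\infty$). -}

module Defs where

open import Level using (Level; _⊔_; suc)
open import Data.Nat as ℕ using (ℕ)
open import Data.Rational as ℚ using (ℚ)
open import Data.Product using (_×_)
open import Relation.Nullary using (¬_)
open import Relation.Binary.PropositionalEquality using (_≡_)
open import Algebra.Bundles using (CommutativeRing)

data ℚ∞ : Set where
  fin : ℚ → ℚ∞
  ∞   : ℚ∞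

infixl 6 _+∞_
_+∞_ : ℚ∞ → ℚ∞ → ℚ∞
fin p +∞ fin q = fin (p ℚ.+ q)
fin _ +∞ ∞     = ∞
∞     +∞ _     = ∞

min∞ : ℚ∞ → ℚ∞ → ℚ∞
min∞ (fin p) (fin q) = fin (p ℚ.⊓ q)
min∞ (fin p) ∞       = fin p
min∞ ∞       y       = y

infix 4 _≤∞_ _<∞_
data _≤∞_ : ℚ∞ → ℚ∞ → Set where
  fin≤fin : ∀ {p q} → p ℚ.≤ q → fin p ≤∞ fin q
  x≤∞     : ∀ {x} → x ≤∞ ∞

data _<∞_ : ℚ∞ → ℚ∞ → Set where
  fin<fin : ∀ {p q} → p ℚ.< q → fin p <∞ fin q
  fin<∞   : ∀ {p} → fin p <∞ ∞

ιR : ∀ {c ℓ} (R : CommutativeRing c ℓ) → ℕ → CommutativeRing.Carrier R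
ιR R ℕ.zero    = CommutativeRing.0# R
ιR R (ℕ.suc n) = CommutativeRing._+_ R (CommutativeRing.1# R) (ιR R n)

record TwoAdicValuedField (c ℓ : Level) : Set (suc (c ⊔ ℓ)) where
  field
    commRing : CommutativeRing c ℓ
  open CommutativeRing commRing public
  ι : ℕ → Carrier
  ι = ιR commRing
  field
    _⁻¹      : Carrier → Carrier
    0≉1      : ¬ (0# ≈ 1#)
    ⁻¹-inverse : ∀ x → ¬ (x ≈ 0#) → x * (x ⁻¹) ≈ 1#

    v        : Carrier → ℚ∞
    v-cong   : ∀ {x y} → x ≈ y → v x ≡ v y
    v-∞⇒0    : ∀ x → v x ≡ ∞ → x ≈ 0#
    v-0      : v 0# ≡ ∞
    v-mul    : ∀ x y → v (x * y) ≡ v x +∞ v y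
    v-add    : ∀ x y → min∞ (v x) (v y) ≤∞ v (x + y)
    -- v extends the 2-adic valuation on ℕ: v(2) = 1, v(odd) = 0
    v-two    : v (ι 2) ≡ fin ℚ.1ℚ
    v-odd    : ∀ m → v (ι (ℕ.suc (2 ℕ.* m))) ≡ fin ℚ.0ℚ

-- Since t = v(r − 1) ≥ 0, the hypothesis τ' ≥ t gives v(a₂² − 2r²) ≥ v(2a₂) = 1 + v(a₂) > 2v(a₂).
-- The ultrametric inequality then forces v(2r²) = v(a₂²), i.e. 1 + 2v(r) = 2v(a₂) < 2.
-- An even r would give v(r) ≥ 1, so r is odd, v(r) = 0 and v(a₂) = 1/2.
module Submission where

open import Defs
open import Data.Nat as ℕ using (ℕ)
open import Data.Nat.Divisibility using (_∣_; divides)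
open import Data.Rational as ℚ using (0ℚ; 1ℚ; ½)
open import Data.Product using (_×_; _,_; ∃)
open import Data.Sum using (_⊎_; inj₁; inj₂)
open import Data.Empty using (⊥-elim)
open import Relation.Nullary using (¬_)
open import Relation.Binary.PropositionalEquality
  using (_≡_; refl; sym; trans; cong; cong₂; subst; subst₂; module ≡-Reasoning)
import Data.Nat.Properties as ℕ
import Data.Rational.Properties as ℚ
import Algebra.Properties.Ring as RingProperties
import Algebra.Properties.AbelianGroup as AbelianGroupProperties
import Algebra.Properties.Semiring.Mult as SemiringMultProperties

even-or-odd : ∀ n → 2 ∣ n ⊎ ∃ λ m → n ≡ ℕ.suc (2 ℕ.* m)
even-or-odd ℕ.zero = inj₁ (divides 0 refl)
even-or-odd (ℕ.suc n) with even-or-odd n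
... | inj₁ (divides q n≡q*2) = inj₂ (q , cong ℕ.suc (trans n≡q*2 (ℕ.*-comm q 2)))
... | inj₂ (m , n≡2m+1)      = inj₁ (divides (ℕ.suc m)
                                 (cong ℕ.suc (trans n≡2m+1 (cong ℕ.suc (ℕ.*-comm 2 m)))))

p+p≡q⇒p≡½*q : ∀ {p q} → p ℚ.+ p ≡ q → p ≡ ½ ℚ.* q
p+p≡q⇒p≡½*q {p} {q} p+p≡q = begin
  p                   ≡⟨ sym (ℚ.*-identityˡ p) ⟩
  1ℚ ℚ.* p            ≡⟨ ℚ.*-distribʳ-+ p ½ ½ ⟩
  ½ ℚ.* p ℚ.+ ½ ℚ.* p ≡⟨ sym (ℚ.*-distribˡ-+ ½ p p) ⟩
  ½ ℚ.* (p ℚ.+ p)     ≡⟨ cong (½ ℚ.*_) p+p≡q ⟩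
  ½ ℚ.* q             ∎
  where open ≡-Reasoning

<⇒≱ : ∀ {p q} → p ℚ.< q → ¬ (q ℚ.≤ p)
<⇒≱ p<q q≤p = ℚ.<-irrefl refl (ℚ.<-≤-trans p<q q≤p)

fin-injective : ∀ {p q} → fin p ≡ fin q → p ≡ q
fin-injective refl = refl

fin≤fin⁻¹ : ∀ {p q} → fin p ≤∞ fin q → p ℚ.≤ q
fin≤fin⁻¹ (fin≤fin p≤q) = p≤q

≤∞-refl : ∀ {x} → x ≤∞ x
≤∞-refl {fin p} = fin≤fin ℚ.≤-refl
≤∞-refl {∞}     = x≤∞

≤∞-reflexive : ∀ {x y} → x ≡ y → x ≤∞ y
≤∞-reflexive refl = ≤∞-refl

≤∞-trans : ∀ {x y z} → x ≤∞ y → y ≤∞ z → x ≤∞ z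
≤∞-trans (fin≤fin p≤q) (fin≤fin q≤r) = fin≤fin (ℚ.≤-trans p≤q q≤r)
≤∞-trans _             x≤∞           = x≤∞

≤∞-antisym : ∀ {x y} → x ≤∞ y → y ≤∞ x → x ≡ y
≤∞-antisym (fin≤fin p≤q) (fin≤fin q≤p) = cong fin (ℚ.≤-antisym p≤q q≤p)
≤∞-antisym x≤∞           x≤∞           = refl

<∞⇒≤∞ : ∀ {x y} → x <∞ y → x ≤∞ y
<∞⇒≤∞ (fin<fin p<q) = fin≤fin (ℚ.<⇒≤ p<q)
<∞⇒≤∞ fin<∞         = x≤∞

<∞-≤∞-trans : ∀ {x y z} → x <∞ y → y ≤∞ z → x <∞ z
<∞-≤∞-trans (fin<fin p<q) (fin≤fin q≤r) = fin<fin (ℚ.<-≤-trans p<q q≤r)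
<∞-≤∞-trans (fin<fin _)   x≤∞           = fin<∞
<∞-≤∞-trans fin<∞         x≤∞           = fin<∞

+∞-identityˡ : ∀ x → fin 0ℚ +∞ x ≡ x
+∞-identityˡ (fin p) = cong fin (ℚ.+-identityˡ p)
+∞-identityˡ ∞       = refl

+∞-mono-≤ : ∀ {x x′ y y′} → x ≤∞ x′ → y ≤∞ y′ → x +∞ y ≤∞ x′ +∞ y′
+∞-mono-≤ (fin≤fin p≤p′) (fin≤fin q≤q′) = fin≤fin (ℚ.+-mono-≤ p≤p′ q≤q′)
+∞-mono-≤ (fin≤fin _)    x≤∞            = x≤∞
+∞-mono-≤ x≤∞            _              = x≤∞

x+∞x≡0⇒x≡0 : ∀ x → x +∞ x ≡ fin 0ℚ → x ≡ fin 0ℚ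
x+∞x≡0⇒x≡0 (fin p) p+p≡0 = cong fin (p+p≡q⇒p≡½*q (fin-injective p+p≡0))

min∞-glb : ∀ {x y z} → z ≤∞ x → z ≤∞ y → z ≤∞ min∞ x y
min∞-glb (fin≤fin r≤p) (fin≤fin r≤q) = fin≤fin (ℚ.⊓-glb r≤p r≤q)
min∞-glb {fin _} z≤x x≤∞ = z≤x
min∞-glb {∞}     _   z≤y = z≤y

x≤y⇒min∞xy≡x : ∀ {x y} → x ≤∞ y → min∞ x y ≡ x
x≤y⇒min∞xy≡x (fin≤fin p≤q) = cong fin (ℚ.p≤q⇒p⊓q≡p p≤q)
x≤y⇒min∞xy≡x {fin _} x≤∞   = refl
x≤y⇒min∞xy≡x {∞}     x≤∞   = refl

min∞xy≤z<y⇒x≤z : ∀ {x y z} → min∞ x y ≤∞ z → z <∞ y → x ≤∞ z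
min∞xy≤z<y⇒x≤z {fin p} {fin q} (fin≤fin p⊓q≤r) (fin<fin r<q) with ℚ.≤-total p q
... | inj₁ p≤q = fin≤fin (subst (ℚ._≤ _) (ℚ.p≤q⇒p⊓q≡p p≤q) p⊓q≤r)
... | inj₂ q≤p = ⊥-elim (<⇒≱ r<q (subst (ℚ._≤ _) (ℚ.p≥q⇒p⊓q≡q q≤p) p⊓q≤r))
min∞xy≤z<y⇒x≤z {fin p} {∞}     p≤z _  = p≤z
min∞xy≤z<y⇒x≤z {∞}     {fin q} (fin≤fin q≤r) (fin<fin r<q) = ⊥-elim (<⇒≱ r<q q≤r)

<∞fin⇒fin : ∀ {x q} → x <∞ fin q → ∃ λ a → x ≡ fin a × a ℚ.< q
<∞fin⇒fin (fin<fin a<q) = _ , refl , a<q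

module Valuation {c ℓ} (K : TwoAdicValuedField c ℓ) where
  open TwoAdicValuedField K renaming (refl to ≈-refl; sym to ≈-sym; trans to ≈-trans)
  open RingProperties ring using (-1*x≈-x)
  open AbelianGroupProperties +-abelianGroup using (⁻¹-involutive; ⁻¹-anti-homo‿-; xyx⁻¹≈y)
  open SemiringMultProperties semiring using (×1-homo-*) renaming (_×_ to _×ₙ_)

  v-1 : v 1# ≡ fin 0ℚ
  v-1 = trans (v-cong (≈-sym (+-identityʳ 1#))) (v-odd 0)

  v-neg : ∀ x → v (- x) ≡ v x
  v-neg x = begin
    v (- x)             ≡⟨ v-cong (≈-sym (-1*x≈-x x)) ⟩
    v (- 1# * x)        ≡⟨ v-mul (- 1#) x ⟩
    v (- 1#) +∞ v x     ≡⟨ cong (_+∞ v x) v-−1 ⟩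
    fin 0ℚ +∞ v x       ≡⟨ +∞-identityˡ (v x) ⟩
    v x                 ∎
    where
    open ≡-Reasoning
    v-−1 : v (- 1#) ≡ fin 0ℚ
    v-−1 = x+∞x≡0⇒x≡0 (v (- 1#)) (begin
      v (- 1#) +∞ v (- 1#) ≡⟨ sym (v-mul (- 1#) (- 1#)) ⟩
      v (- 1# * - 1#)      ≡⟨ v-cong (≈-trans (-1*x≈-x (- 1#)) (⁻¹-involutive 1#)) ⟩
      v 1#                 ≡⟨ v-1 ⟩
      fin 0ℚ               ∎)

  v-finite⇒≉0 : ∀ {x p} → v x ≡ fin p → ¬ (x ≈ 0#)
  v-finite⇒≉0 vx≡p x≈0 with trans (sym vx≡p) (trans (v-cong x≈0) v-0)
  ... | ()

  vx<vy⇒v[x+y]≡vx : ∀ {x y} → v x <∞ v y → v (x + y) ≡ v x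
  vx<vy⇒v[x+y]≡vx {x} {y} vx<vy = ≤∞-antisym v[x+y]≤vx vx≤v[x+y]
    where
    vx≤v[x+y] : v x ≤∞ v (x + y)
    vx≤v[x+y] = subst (_≤∞ v (x + y)) (x≤y⇒min∞xy≡x (<∞⇒≤∞ vx<vy)) (v-add x y)
    x+y-y≈x : (x + y) - y ≈ x
    x+y-y≈x = ≈-trans (+-assoc x y (- y)) (≈-trans (+-congˡ (-‿inverseʳ y)) (+-identityʳ x))
    v[x+y]≤vx : v (x + y) ≤∞ v x
    v[x+y]≤vx = min∞xy≤z<y⇒x≤z
      (subst (min∞ (v (x + y)) (v (- y)) ≤∞_) (v-cong x+y-y≈x) (v-add (x + y) (- y)))
      (subst (v x <∞_) (sym (v-neg y)) vx<vy)

  vx<v[x-y]⇒vy≡vx : ∀ {x y} → v x <∞ v (x - y) → v y ≡ v x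
  vx<v[x-y]⇒vy≡vx {x} {y} vx<v[x-y] = trans (v-cong (≈-sym x-[x-y]≈y))
    (vx<vy⇒v[x+y]≡vx (subst (v x <∞_) (sym (v-neg (x - y))) vx<v[x-y]))
    where
    x-[x-y]≈y : x - (x - y) ≈ y
    x-[x-y]≈y = ≈-trans (+-congˡ (⁻¹-anti-homo‿- x y)) (≈-trans (≈-sym (+-assoc x y (- x))) (xyx⁻¹≈y x y))

  v-quotient-nonneg : ∀ {x y} → ¬ (y ≈ 0#) → fin 0ℚ ≤∞ v (x * y ⁻¹) → v y ≤∞ v x
  v-quotient-nonneg {x} {y} y≉0 0≤v[x/y] = subst₂ _≤∞_ (+∞-identityˡ (v y)) v[x/y*y]≡vx
    (+∞-mono-≤ 0≤v[x/y] ≤∞-refl)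
    where
    x/y*y≈x : (x * y ⁻¹) * y ≈ x
    x/y*y≈x = ≈-trans (*-assoc x (y ⁻¹) y)
      (≈-trans (*-congˡ (≈-trans (*-comm (y ⁻¹) y) (⁻¹-inverse y y≉0))) (*-identityʳ x))
    v[x/y*y]≡vx : v (x * y ⁻¹) +∞ v y ≡ v x
    v[x/y*y]≡vx = trans (sym (v-mul (x * y ⁻¹) y)) (v-cong x/y*y≈x)

  ι≈×1 : ∀ n → ι n ≈ n ×ₙ 1#
  ι≈×1 ℕ.zero    = ≈-refl
  ι≈×1 (ℕ.suc n) = +-congˡ (ι≈×1 n)

  ι-homo-* : ∀ m n → ι (m ℕ.* n) ≈ ι m * ι n
  ι-homo-* m n = ≈-trans (ι≈×1 (m ℕ.* n))
    (≈-trans (×1-homo-* m n) (*-cong (≈-sym (ι≈×1 m)) (≈-sym (ι≈×1 n))))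

  v-ι-nonneg : ∀ n → fin 0ℚ ≤∞ v (ι n)
  v-ι-nonneg ℕ.zero    = subst (fin 0ℚ ≤∞_) (sym v-0) x≤∞
  v-ι-nonneg (ℕ.suc n) = ≤∞-trans (min∞-glb (≤∞-reflexive (sym v-1)) (v-ι-nonneg n)) (v-add 1# (ι n))

  v-ι-even : ∀ {n} → 2 ∣ n → fin 1ℚ ≤∞ v (ι n)
  v-ι-even (divides q refl) = subst (fin 1ℚ ≤∞_)
    (sym (trans (v-cong (ι-homo-* q 2)) (v-mul (ι q) (ι 2))))
    (+∞-mono-≤ (v-ι-nonneg q) (≤∞-reflexive (sym v-two)))

  v-ι-pred-nonneg : ∀ {n} → 1 ℕ.≤ n → fin 0ℚ ≤∞ v (ι n - 1#)
  v-ι-pred-nonneg {ℕ.suc n} _ = subst (fin 0ℚ ≤∞_) (v-cong (≈-sym 1+ιn-1≈ιn)) (v-ι-nonneg n)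
    where
    1+ιn-1≈ιn : (1# + ι n) - 1# ≈ ι n
    1+ιn-1≈ιn = ≈-trans (+-congʳ (+-comm 1# (ι n)))
      (≈-trans (+-assoc (ι n) 1# (- 1#)) (≈-trans (+-congˡ (-‿inverseʳ 1#)) (+-identityʳ (ι n))))

  v-2n² : ∀ n → v (ι 2 * (ι n * ι n)) ≡ fin 1ℚ +∞ (v (ι n) +∞ v (ι n))
  v-2n² n = trans (v-mul (ι 2) (ι n * ι n)) (cong₂ _+∞_ v-two (v-mul (ι n) (ι n)))

  0≤v[α′]⇒vb≡2a : ∀ {a₂ b a} → v a₂ ≡ fin a → a ℚ.< 1ℚ →
                   fin 0ℚ ≤∞ v ((a₂ * a₂ - b) * (ι 2 * a₂) ⁻¹) → v b ≡ fin (a ℚ.+ a)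
  0≤v[α′]⇒vb≡2a {a₂} {b} {a} v[a₂]≡a a<1 0≤v[α′] = trans (vx<v[x-y]⇒vy≡vx v[a₂²]<v[a₂²-b]) v[a₂²]≡2a
    where
    v[a₂²]≡2a : v (a₂ * a₂) ≡ fin (a ℚ.+ a)
    v[a₂²]≡2a = trans (v-mul a₂ a₂) (cong₂ _+∞_ v[a₂]≡a v[a₂]≡a)
    v[2a₂]≡1+a : v (ι 2 * a₂) ≡ fin (1ℚ ℚ.+ a)
    v[2a₂]≡1+a = trans (v-mul (ι 2) a₂) (cong₂ _+∞_ v-two v[a₂]≡a)
    v[a₂²]<v[a₂²-b] : v (a₂ * a₂) <∞ v (a₂ * a₂ - b)
    v[a₂²]<v[a₂²-b] = subst₂ _<∞_ (sym v[a₂²]≡2a) refl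
      (<∞-≤∞-trans (subst (fin (a ℚ.+ a) <∞_) (sym v[2a₂]≡1+a) (fin<fin (ℚ.+-monoˡ-< a a<1)))
                   (v-quotient-nonneg (v-finite⇒≉0 v[2a₂]≡1+a) 0≤v[α′]))

lemma3p7 : ∀ {c ℓ} (K : TwoAdicValuedField c ℓ) → let open TwoAdicValuedField K in
    (r : ℕ) → 2 ℕ.≤ r → (a₂ : Carrier) →
    fin ℚ.0ℚ <∞ v a₂ → v a₂ <∞ fin ℚ.1ℚ →
    v (ι r - 1#) ≤∞ v ((a₂ * a₂ - ι 2 * (ι r * ι r)) * ((ι 2 * a₂) ⁻¹)) →
    (¬ (2 ∣ r)) × (v a₂ ≡ fin ℚ.½)
lemma3p7 K r 2≤r a₂ _ v[a₂]<1 t≤τ′ with <∞fin⇒fin v[a₂]<1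
... | a , v[a₂]≡a , a<1 = r-odd , v[a₂]≡½
  where
  open TwoAdicValuedField K hiding (refl; sym; trans)
  open Valuation K
  v[2r²]≡2a : v (ι 2 * (ι r * ι r)) ≡ fin (a ℚ.+ a)
  v[2r²]≡2a = 0≤v[α′]⇒vb≡2a v[a₂]≡a a<1 (≤∞-trans (v-ι-pred-nonneg (ℕ.<⇒≤ 2≤r)) t≤τ′)
  r-odd : ¬ (2 ∣ r)
  r-odd 2∣r = <⇒≱ (ℚ.+-mono-< a<1 a<1) (fin≤fin⁻¹ 2≤2a)
    where
    -- Closed rationals normalise, so 1 + (1 + 0) is the 1 + 1 bounding a + a above.
    2≤2a : fin (1ℚ ℚ.+ (1ℚ ℚ.+ 0ℚ)) ≤∞ fin (a ℚ.+ a)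
    2≤2a = subst (_ ≤∞_) (trans (sym (v-2n² r)) v[2r²]≡2a)
      (+∞-mono-≤ ≤∞-refl (+∞-mono-≤ (v-ι-even 2∣r) (v-ι-nonneg r)))
  v[a₂]≡½ : v a₂ ≡ fin ½
  v[a₂]≡½ with even-or-odd r
  ... | inj₁ 2∣r        = ⊥-elim (r-odd 2∣r)
  ... | inj₂ (m , refl) = trans v[a₂]≡a (cong fin (p+p≡q⇒p≡½*q (fin-injective a+a≡1)))
    where
    a+a≡1 : fin (a ℚ.+ a) ≡ fin 1ℚ
    a+a≡1 = trans (sym v[2r²]≡2a) (trans (v-2n² r) (cong (λ z → fin 1ℚ +∞ (z +∞ z)) (v-odd m)))
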